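{- Let $p$ be an odd prime. Then $2^{p-1}\equiv 1\pmod{p^2}$ (i.e. $p$ is a Wieferich prime) if and only if there exists an integer $x$ with $2^p-1\equiv x^p\pmod{p^2}$. -}

module Defs where

open import Data.Integer using (ℤ; _-_)
open import Data.Integer.Divisibility using (_∣_)

infix 4 _≡_[mod_]
_≡_[mod_] : ℤ → ℤ → ℤ → Set
a ≡ b [mod m ] = m ∣ (a - b)

-- Fermat's little theorem, from p ∣ p C k for 0 < k < p, reduces 2 ^ p - 1 ≡ x ^ p (mod p²)
-- modulo p to x ≡ 2 - 1 = 1 (mod p).  Writing x = 1 + d with p ∣ d, (1 + d) ^ p ≡ 1 + p d (mod d²)
-- gives x ^ p ≡ 1 (mod p²), so 2 · 2 ^ (p - 1) ≡ 2 (mod p²), and 2 can be cancelled because p² is odd.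
-- Conversely, if 2 ^ (p - 1) ≡ 1 (mod p²) then x = 1 works.
module Submission where

open import Defs
open import Data.Nat using (ℕ; _∸_)
open import Data.Nat.Primality using (Prime)
open import Data.Nat.Divisibility using () renaming (_∣_ to _∣ℕ_)
open import Data.Integer using (ℤ; +_; _-_; _^_; 1ℤ)
open import Data.Product using (∃)
open import Function.Bundles using (_⇔_)
open import Relation.Nullary using (¬_)

import Data.Integer.Properties as ℤ
open import Algebra.Properties.CommutativeSemiring.Binomial ℤ.+-*-commutativeSemiring
  using (binomialExpansion; binomialTerm) renaming (theorem to binomial-theorem)
open import Algebra.Properties.Semiring.Exp ℤ.+-*-semiring using () renaming (_^_ to _^ᵉ_)
open import Algebra.Properties.Semiring.Mult ℤ.+-*-semiring using (_×_)
open import Algebra.Properties.Semiring.Sum ℤ.+-*-semiring using (sum; sum-init-last)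
open import Data.Fin using (zero; suc; inject₁)
open import Data.Fin.Properties using (toℕ-fromℕ; inject₁ℕ<)
open import Data.Integer using (+[1+_]; -[1+_]; _+_; _*_; -_; 0ℤ; ∣_∣)
open import Data.Integer.Coprimality using (Coprime; coprime-divisor)
open import Data.Integer.Divisibility.Signed
  using (_∣_; divides; ∣ᵤ⇒∣; ∣⇒∣ᵤ; ∣-refl; ∣-trans; ∣m∣n⇒∣m+n; ∣m⇒∣-m; ∣m⇒∣m*n; ∣n⇒∣m*n; *-monoʳ-∣; *-monoˡ-∣)
open import Data.Integer.Tactic.RingSolver using (solve-∀)
open import Data.Nat as ℕ using (zero; suc; _<_; _≤_; _!; z<s; s<s)
import Data.Nat.Coprimality as ℕ using (Coprime)
open import Data.Nat.Combinatorics using (_C_; nCn≡1; k![n∸k]!∣n!)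
open import Data.Nat.Combinatorics.Specification using (nCk≡n!/k![n-k]!)
open import Data.Nat.Divisibility using (_∤_; _∣0; ∣1⇒≡1; 0∣⇒≡0; ∣⇒≤; >⇒∤; m∣m*n)
open import Data.Nat.DivMod using (m*[n/m]≡n)
open import Data.Nat.Primality using (¬prime[1]; prime[2]; euclidsLemma)
open import Data.Nat.Properties using (<-trans; n<1+n; <⇒≤; ∸-monoʳ-<; n∸n≡0; _!*_!≢0)
open import Data.Product using (_,_)
open import Data.Sum using (inj₁; inj₂)
open import Data.Vec.Functional using (Vector; head; tail; init; last)
open import Function using (_∘_; mk⇔)
open import Level using (0ℓ)
open import Relation.Binary.Bundles using (Setoid)
open import Relation.Binary.PropositionalEquality using (_≡_; refl; subst; sym; trans; cong; cong₂; module ≡-Reasoning)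
import Relation.Binary.Reasoning.Setoid as SetoidReasoning
open import Relation.Nullary using (contradiction)

variable
  a b c d x m : ℤ
  k n p : ℕ

prime∤1 : Prime p → p ∤ 1
prime∤1 pr p∣1 = ¬prime[1] (subst Prime (∣1⇒≡1 p∣1) pr)

prime∤! : Prime p → k < p → p ∤ k !
prime∤! {k = zero} pr _ = prime∤1 pr
prime∤! {k = suc k} pr 1+k<p p∣[1+k]! with euclidsLemma (suc k) (k !) pr p∣[1+k]!
... | inj₁ p∣1+k = >⇒∤ 1+k<p p∣1+k
... | inj₂ p∣k! = prime∤! pr (<-trans (n<1+n k) 1+k<p) p∣k!

prime∤^ : Prime p → p ∤ n → p ∤ n ℕ.^ k
prime∤^ {k = zero} pr _ = prime∤1 pr
prime∤^ {n = n} {k = suc k} pr p∤n p∣n^[1+k] with euclidsLemma n (n ℕ.^ k) pr p∣n^[1+k]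
... | inj₁ p∣n = p∤n p∣n
... | inj₂ p∣n^k = prime∤^ {k = k} pr p∤n p∣n^k

k![n∸k]!*nCk≡n! : k ≤ n → k ! ℕ.* (n ∸ k) ! ℕ.* (n C k) ≡ n !
k![n∸k]!*nCk≡n! {k} {n} k≤n =
  trans (cong (k ! ℕ.* (n ∸ k) ! ℕ.*_) (nCk≡n!/k![n-k]! k≤n)) (m*[n/m]≡n (k![n∸k]!∣n! k≤n))
  where instance _ = k !* (n ∸ k) !≢0

prime∣C : Prime p → 0 < k → k < p → p ∣ℕ p C k
prime∣C {p@(suc n)} {k} pr 0<k k<p
  with euclidsLemma (k ! ℕ.* (p ∸ k) !) (p C k) pr
         (subst (p ∣ℕ_) (sym (k![n∸k]!*nCk≡n! (<⇒≤ k<p))) (m∣m*n (n !)))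
... | inj₂ p∣pCk = p∣pCk
... | inj₁ p∣k!*[p∸k]! with euclidsLemma (k !) ((p ∸ k) !) pr p∣k!*[p∸k]!
...   | inj₁ p∣k! = contradiction p∣k! (prime∤! pr k<p)
...   | inj₂ p∣[p∸k]! = contradiction p∣[p∸k]! (prime∤! pr (∸-monoʳ-< 0<k (<⇒≤ k<p)))

odd⇒coprime[2] : 2 ∤ n → ℕ.Coprime n 2
odd⇒coprime[2] _ {zero} (_ , 0∣2) = contradiction (0∣⇒≡0 0∣2) λ ()
odd⇒coprime[2] _ {1} _ = refl
odd⇒coprime[2] 2∤n {2} (2∣n , _) = contradiction 2∣n 2∤n
odd⇒coprime[2] _ {suc (suc (suc _))} (_ , d∣2) with ∣⇒≤ d∣2
... | s<s (s<s ())

-- `a ≡ b [mod m ]` unfolds to a divisibility between the absolute values ∣ m ∣ and ∣ a - b ∣,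
-- from which Agda cannot infer a, b or m; this record keeps them as indices.
infix 4 _≋_[mod_]
record _≋_[mod_] (a b m : ℤ) : Set where
  constructor mod
  field divides-difference : m ∣ a - b

≡-mod⇒≋ : a ≡ b [mod m ] → a ≋ b [mod m ]
≡-mod⇒≋ {a} {b} a≡b = mod (∣ᵤ⇒∣ {i = a - b} a≡b)

≋⇒≡-mod : a ≋ b [mod m ] → a ≡ b [mod m ]
≋⇒≡-mod (mod m∣a-b) = ∣⇒∣ᵤ m∣a-b

≋-refl : a ≋ a [mod m ]
≋-refl {a} = mod (divides 0ℤ (ℤ.+-inverseʳ a))

≋-sym : a ≋ b [mod m ] → b ≋ a [mod m ]
≋-sym {a} {b} {m} (mod m∣a-b) = mod (subst (m ∣_) (negate a b) (∣m⇒∣-m m∣a-b))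
  where
  negate : ∀ a b → - (a - b) ≡ b - a
  negate = solve-∀

≋-trans : a ≋ b [mod m ] → b ≋ c [mod m ] → a ≋ c [mod m ]
≋-trans {a} {b} {m} {c} (mod m∣a-b) (mod m∣b-c) =
  mod (subst (m ∣_) (ℤ.+-minus-telescope a b c) (∣m∣n⇒∣m+n m∣a-b m∣b-c))

≋-setoid : ℤ → Setoid 0ℓ 0ℓ
≋-setoid m = record
  { Carrier = ℤ
  ; _≈_ = λ a b → a ≋ b [mod m ]
  ; isEquivalence = record { refl = ≋-refl ; sym = ≋-sym ; trans = ≋-trans }
  }

module ≋-Reasoning (m : ℤ) = SetoidReasoning (≋-setoid m)

∣⇒≋0 : m ∣ a → a ≋ 0ℤ [mod m ]
∣⇒≋0 {m} {a} m∣a = mod (subst (m ∣_) (sym (ℤ.+-identityʳ a)) m∣a)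

≋-weaken : m ∣ c → a ≋ b [mod c ] → a ≋ b [mod m ]
≋-weaken m∣c (mod c∣a-b) = mod (∣-trans m∣c c∣a-b)

≋-+-cong : a ≋ b [mod m ] → c ≋ d [mod m ] → a + c ≋ b + d [mod m ]
≋-+-cong {a} {b} {m} {c} {d} (mod m∣a-b) (mod m∣c-d) =
  mod (subst (m ∣_) (regroup a b c d) (∣m∣n⇒∣m+n m∣a-b m∣c-d))
  where
  regroup : ∀ a b c d → (a - b) + (c - d) ≡ (a + c) - (b + d)
  regroup = solve-∀

≋-*-cong : a ≋ b [mod m ] → c ≋ d [mod m ] → a * c ≋ b * d [mod m ]
≋-*-cong {a} {b} {m} {c} {d} (mod m∣a-b) (mod m∣c-d) =
  mod (subst (m ∣_) (regroup a b c d) (∣m∣n⇒∣m+n (∣m⇒∣m*n c m∣a-b) (∣n⇒∣m*n b m∣c-d)))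
  where
  regroup : ∀ a b c d → (a - b) * c + b * (c - d) ≡ a * c - b * d
  regroup = solve-∀

≋-+-cancelˡ : c + a ≋ c + b [mod m ] → a ≋ b [mod m ]
≋-+-cancelˡ {c} {a} {b} {m} (mod m∣ca-cb) = mod (subst (m ∣_) (cancel c a b) m∣ca-cb)
  where
  cancel : ∀ c a b → (c + a) - (c + b) ≡ a - b
  cancel = solve-∀

≋-*-cancelˡ : Coprime m c → c * a ≋ c * b [mod m ] → a ≋ b [mod m ]
≋-*-cancelˡ {m} {c} {a} {b} m⊥c (mod m∣ca-cb) =
  ≡-mod⇒≋ (coprime-divisor m c (a - b) m⊥c (∣⇒∣ᵤ (subst (m ∣_) (factor c a b) m∣ca-cb)))
  where
  factor : ∀ c a b → c * a - c * b ≡ c * (a - b)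
  factor = solve-∀

×≡* : ∀ k a → k × a ≡ + k * a
×≡* zero a = refl
×≡* (suc k) a = trans (cong (_+_ a) (×≡* k a)) (sym (ℤ.suc-* (+ k) a))

∣ℕ⇒∣× : ∀ a → n ∣ℕ k → + n ∣ k × a
∣ℕ⇒∣× {n} {k} a n∣k rewrite ×≡* k a = ∣m⇒∣m*n a (∣ᵤ⇒∣ {+ n} {+ k} n∣k)

∣-sum : (t : Vector ℤ n) → (∀ i → m ∣ t i) → m ∣ sum t
∣-sum {zero} t _ = divides 0ℤ refl
∣-sum {suc n} t m∣t = ∣m∣n⇒∣m+n (m∣t zero) (∣-sum (tail t) (m∣t ∘ suc))

sum≋head+last : (t : Vector ℤ (suc (suc n))) → (∀ i → m ∣ t (suc (inject₁ i))) →
                sum t ≋ head t + last t [mod m ]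
sum≋head+last {m = m} t m∣inner = begin
  head t + sum (tail t)                    ≡⟨ cong (_+_ (head t)) (sum-init-last (tail t)) ⟩
  head t + (sum (init (tail t)) + last t)
    ≈⟨ ≋-+-cong (≋-refl {head t}) (≋-+-cong (∣⇒≋0 (∣-sum (init (tail t)) m∣inner)) (≋-refl {last t})) ⟩
  head t + (0ℤ + last t)                   ≡⟨ cong (_+_ (head t)) (ℤ.+-identityˡ (last t)) ⟩
  head t + last t                          ∎
  where open ≋-Reasoning m

-- The binomial theorem is stated with the semiring exponentiation _^ᵉ_, which agrees with
-- ℤ's _^_ only propositionally.
^≡^ᵉ : ∀ a n → a ^ n ≡ a ^ᵉ n
^≡^ᵉ a zero = refl
^≡^ᵉ a (suc n) = cong (_*_ a) (^≡^ᵉ a n)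

head-binomialTerm : ∀ a b n → head (binomialTerm a b n) ≡ b ^ n
head-binomialTerm a b n = begin
  1ℤ * b ^ᵉ n + 0ℤ  ≡⟨ ℤ.+-identityʳ (1ℤ * b ^ᵉ n) ⟩
  1ℤ * b ^ᵉ n       ≡⟨ ℤ.*-identityˡ (b ^ᵉ n) ⟩
  b ^ᵉ n            ≡⟨ ^≡^ᵉ b n ⟨
  b ^ n             ∎
  where open ≡-Reasoning

last-binomialTerm : ∀ a b n → last (binomialTerm a b n) ≡ a ^ n
last-binomialTerm a b n = begin
  last (binomialTerm a b n)         ≡⟨ cong (λ k → (n C k) × (a ^ᵉ k * b ^ᵉ (n ∸ k))) (toℕ-fromℕ n) ⟩
  (n C n) × (a ^ᵉ n * b ^ᵉ (n ∸ n)) ≡⟨ cong₂ (λ c k → c × (a ^ᵉ n * b ^ᵉ k)) (nCn≡1 n) (n∸n≡0 n) ⟩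
  a ^ᵉ n * 1ℤ + 0ℤ                  ≡⟨ ℤ.+-identityʳ (a ^ᵉ n * 1ℤ) ⟩
  a ^ᵉ n * 1ℤ                       ≡⟨ ℤ.*-identityʳ (a ^ᵉ n) ⟩
  a ^ᵉ n                            ≡⟨ ^≡^ᵉ a n ⟨
  a ^ n                             ∎
  where open ≡-Reasoning

[1+a]^p≋1+a^p : Prime p → ∀ a → (1ℤ + a) ^ p ≋ 1ℤ + a ^ p [mod + p ]
[1+a]^p≋1+a^p {p@(suc n)} pr a = begin
  (1ℤ + a) ^ p               ≡⟨ ^≡^ᵉ (1ℤ + a) p ⟩
  (1ℤ + a) ^ᵉ p              ≡⟨ binomial-theorem p 1ℤ a ⟩
  binomialExpansion 1ℤ a p   ≈⟨ sum≋head+last t p∣inner ⟩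
  head t + last t
    ≡⟨ cong₂ _+_ (head-binomialTerm 1ℤ a p) (trans (last-binomialTerm 1ℤ a p) (ℤ.^-zeroˡ p)) ⟩
  a ^ p + 1ℤ                 ≡⟨ ℤ.+-comm (a ^ p) 1ℤ ⟩
  1ℤ + a ^ p                 ∎
  where
  open ≋-Reasoning (+ p)
  t : Vector ℤ (suc p)
  t = binomialTerm 1ℤ a p
  p∣inner : ∀ i → + p ∣ t (suc (inject₁ i))
  p∣inner i = ∣ℕ⇒∣× _ (prime∣C pr z<s (s<s (inject₁ℕ< i)))

fermat-suc : Prime p → a ^ p ≋ a [mod + p ] → (1ℤ + a) ^ p ≋ 1ℤ + a [mod + p ]
fermat-suc {a = a} pr aᵖ≋a = ≋-trans ([1+a]^p≋1+a^p pr a) (≋-+-cong (≋-refl {1ℤ}) aᵖ≋a)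

fermat-pred : Prime p → (1ℤ + a) ^ p ≋ 1ℤ + a [mod + p ] → a ^ p ≋ a [mod + p ]
fermat-pred {a = a} pr [1+a]ᵖ≋1+a = ≋-+-cancelˡ {1ℤ} (≋-trans (≋-sym ([1+a]^p≋1+a^p pr a)) [1+a]ᵖ≋1+a)

fermat : Prime p → ∀ a → a ^ p ≋ a [mod + p ]
fermat {suc _} pr (+ zero) = ≋-refl
fermat pr +[1+ n ] = fermat-suc pr (fermat pr (+ n))
fermat {suc _} pr -[1+ zero ] = fermat-pred pr ≋-refl
fermat pr -[1+ suc n ] = fermat-pred pr (fermat pr -[1+ n ])

[1+d]^n≋1+n*d : ∀ d n → (1ℤ + d) ^ n ≋ 1ℤ + + n * d [mod d ^ 2 ]
[1+d]^n≋1+n*d d zero = ≋-refl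
[1+d]^n≋1+n*d d (suc n) = begin
  (1ℤ + d) * (1ℤ + d) ^ n     ≈⟨ ≋-*-cong (≋-refl {1ℤ + d}) ([1+d]^n≋1+n*d d n) ⟩
  (1ℤ + d) * (1ℤ + + n * d)   ≈⟨ mod (divides (+ n) (expand (+ n) d)) ⟩
  1ℤ + + suc n * d            ∎
  where
  open ≋-Reasoning (d ^ 2)
  expand : ∀ k d → (1ℤ + d) * (1ℤ + k * d) - (1ℤ + (1ℤ + k) * d) ≡ k * (d * (d * 1ℤ))
  expand = solve-∀

∣⇒∣^ : m ∣ a → m ^ k ∣ a ^ k
∣⇒∣^ {k = zero} _ = ∣-refl
∣⇒∣^ {m} {a} {suc k} m∣a = ∣-trans (*-monoˡ-∣ (m ^ k) m∣a) (*-monoʳ-∣ a (∣⇒∣^ {k = k} m∣a))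

≋1⇒^≋1 : x ≋ 1ℤ [mod m ] → m ∣ + n → x ^ n ≋ 1ℤ [mod m ^ 2 ]
≋1⇒^≋1 {x} {m} {n} (mod m∣δ) m∣n = begin
  x ^ n           ≡⟨ cong (_^ n) (1+[x-1]≡x x) ⟨
  (1ℤ + δ) ^ n    ≈⟨ ≋-weaken (∣⇒∣^ {k = 2} m∣δ) ([1+d]^n≋1+n*d δ n) ⟩
  1ℤ + + n * δ    ≈⟨ ≋-+-cong (≋-refl {1ℤ}) (∣⇒≋0 m²∣nδ) ⟩
  1ℤ              ∎
  where
  open ≋-Reasoning (m ^ 2)
  δ : ℤ
  δ = x - 1ℤ
  1+[x-1]≡x : ∀ x → 1ℤ + (x - 1ℤ) ≡ x
  1+[x-1]≡x = solve-∀
  m²∣nδ : m ^ 2 ∣ + n * δ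
  m²∣nδ = subst (_∣ + n * δ) (cong (_*_ m) (sym (ℤ.^-identityʳ m)))
                (∣-trans (*-monoˡ-∣ m m∣n) (*-monoʳ-∣ (+ n) m∣δ))

∣i^n∣≡∣i∣^n : ∀ i n → ∣ i ^ n ∣ ≡ ∣ i ∣ ℕ.^ n
∣i^n∣≡∣i∣^n i zero = refl
∣i^n∣≡∣i∣^n i (suc n) = trans (ℤ.abs-* i (i ^ n)) (cong (∣ i ∣ ℕ.*_) (∣i^n∣≡∣i∣^n i n))

odd⇒coprime[p²,2] : 2 ∤ p → Coprime ((+ p) ^ 2) (+ 2)
odd⇒coprime[p²,2] {p} 2∤p =
  subst (λ m → ℕ.Coprime m 2) (sym (∣i^n∣≡∣i∣^n (+ p) 2))
        (odd⇒coprime[2] (prime∤^ {k = 2} prime[2] 2∤p))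

2^n≋1⇒2^[1+n]-1≋1^[1+n] : (+ 2) ^ n ≋ 1ℤ [mod m ] → (+ 2) ^ suc n - 1ℤ ≋ 1ℤ ^ suc n [mod m ]
2^n≋1⇒2^[1+n]-1≋1^[1+n] {n} {m} 2ⁿ≋1 = begin
  + 2 * (+ 2) ^ n - 1ℤ   ≈⟨ ≋-+-cong (≋-*-cong (≋-refl {+ 2}) 2ⁿ≋1) (≋-refl { - 1ℤ}) ⟩
  1ℤ                     ≡⟨ ℤ.^-zeroˡ (suc n) ⟨
  1ℤ ^ suc n             ∎
  where open ≋-Reasoning m

2^p-1≋x^p⇒x≋1 : Prime p → (+ 2) ^ p - 1ℤ ≋ x ^ p [mod (+ p) ^ 2 ] → x ≋ 1ℤ [mod + p ]
2^p-1≋x^p⇒x≋1 {p} {x} pr 2ᵖ-1≋xᵖ = begin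
  x                ≈⟨ fermat pr x ⟨
  x ^ p            ≈⟨ ≋-weaken (∣m⇒∣m*n _ ∣-refl) 2ᵖ-1≋xᵖ ⟨
  (+ 2) ^ p - 1ℤ   ≈⟨ ≋-+-cong (fermat pr (+ 2)) (≋-refl { - 1ℤ}) ⟩
  1ℤ               ∎
  where open ≋-Reasoning (+ p)

2^p-1≋x^p⇒2^[p-1]≋1 : Prime p → 2 ∤ p → (+ 2) ^ p - 1ℤ ≋ x ^ p [mod (+ p) ^ 2 ] →
                      (+ 2) ^ (p ∸ 1) ≋ 1ℤ [mod (+ p) ^ 2 ]
2^p-1≋x^p⇒2^[p-1]≋1 {p@(suc n)} {x} pr 2∤p 2ᵖ-1≋xᵖ =
  ≋-*-cancelˡ {c = + 2} (odd⇒coprime[p²,2] 2∤p) (begin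
  + 2 * (+ 2) ^ n               ≡⟨ a-1+1≡a (+ 2 * (+ 2) ^ n) ⟨
  (+ 2) ^ p - 1ℤ + 1ℤ           ≈⟨ ≋-+-cong (≋-trans 2ᵖ-1≋xᵖ xᵖ≋1) (≋-refl {1ℤ}) ⟩
  + 2 * 1ℤ                      ∎)
  where
  open ≋-Reasoning ((+ p) ^ 2)
  a-1+1≡a : ∀ a → a - 1ℤ + 1ℤ ≡ a
  a-1+1≡a = solve-∀
  xᵖ≋1 : x ^ p ≋ 1ℤ [mod (+ p) ^ 2 ]
  xᵖ≋1 = ≋1⇒^≋1 {x} (2^p-1≋x^p⇒x≋1 pr 2ᵖ-1≋xᵖ) ∣-refl

lemma5 : (p : ℕ) → Prime p → ¬ (2 ∣ℕ p) →
    ((+ 2) ^ (p ∸ 1) ≡ 1ℤ [mod (+ p) ^ 2 ])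
    ⇔ ∃ (λ (x : ℤ) → ((+ 2) ^ p - 1ℤ) ≡ x ^ p [mod (+ p) ^ 2 ])
lemma5 zero _ 2∤0 = contradiction (2 ∣0) 2∤0
lemma5 p@(suc n) pr 2∤p = mk⇔
  (λ 2ᵖ⁻¹≡1 → 1ℤ , ≋⇒≡-mod (2^n≋1⇒2^[1+n]-1≋1^[1+n] {n} {(+ p) ^ 2} (≡-mod⇒≋ 2ᵖ⁻¹≡1)))
  (λ (x , 2ᵖ-1≡xᵖ) → ≋⇒≡-mod (2^p-1≋x^p⇒2^[p-1]≋1 {x = x} pr 2∤p (≡-mod⇒≋ 2ᵖ-1≡xᵖ)))
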